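{- For all positive integers $n$, $r$, and $s$, $$\binom{n+r}{n}\sum_{k=0}^{s-1}\binom{r+k}{r-1}\binom{n+k}{n} = \binom{n+s}{n}\sum_{k=0}^{r-1}\binom{s+k}{s-1}\binom{n+k}{n}.$$ -}

module Defs where

open import Data.Nat using (ℕ; zero; suc; _+_)

sumBelow : ℕ → (ℕ → ℕ) → ℕ
sumBelow zero    f = 0
sumBelow (suc s) f = sumBelow s f + f s

-- Write B x y = C(x+y, x), which is symmetric and obeys Pascal's rule in the
-- form B (x+1) (y+1) = B x (y+1) + B (x+1) y.  With r = a+1, s = b+1 the claim
-- is that  Φ a b = B n (a+1) · S a (b+1)  is symmetric, where
--   S a m = Σ_{k<m} B a (k+1) · B n k.
-- Extending the sum by one term gives  Φ a (b+1) = Φ a b + δ a b  by definition.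
-- The heart of the proof is that raising the first index has the same effect,
-- Φ (b+1) a = Φ b a + δ a b; it follows by telescoping in the summation index,
-- each telescoping step being an identity between binomials that reduces,
-- via the absorption rule (y+1) B x (y+1) = (x+y+1) B x y, to a polynomial
-- identity.  Symmetry of Φ then follows by a lexicographic double induction.
module Submission where

open import Defs
open import Data.Nat using (ℕ; zero; suc; _+_; _*_; _∸_; _≥_; s≤s; z≤n)
open import Data.Nat.Combinatorics using (_C_; nCn≡1; nCk+nC[k+1]≡[n+1]C[k+1])
open import Data.Nat.Properties using (+-comm; +-suc; +-identityʳ; *-zeroʳ; *-distribˡ-+; *-cancelˡ-≡)
open import Data.Nat.Tactic.RingSolver using (solve-∀)
open import Relation.Binary.PropositionalEquality using (_≡_; refl; sym; trans; cong; cong₂)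
open Relation.Binary.PropositionalEquality.≡-Reasoning

B : ℕ → ℕ → ℕ
B zero    y       = 1
B (suc x) zero    = 1
B (suc x) (suc y) = B x (suc y) + B (suc x) y

B≡C : ∀ x y → B x y ≡ (x + y) C x
B≡C zero    y       = refl
B≡C (suc x) zero    = trans (sym (nCn≡1 (suc x))) (cong (_C suc x) (sym (+-identityʳ (suc x))))
B≡C (suc x) (suc y) = begin
  B x (suc y) + B (suc x) y              ≡⟨ cong₂ _+_ (B≡C x (suc y)) (B≡C (suc x) y) ⟩
  (x + suc y) C x + (suc x + y) C suc x  ≡⟨ cong (λ t → (x + suc y) C x + t C suc x) (sym (+-suc x y)) ⟩
  (x + suc y) C x + (x + suc y) C suc x  ≡⟨ nCk+nC[k+1]≡[n+1]C[k+1] (x + suc y) x ⟩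
  suc (x + suc y) C suc x                ∎

B-sym : ∀ x y → B x y ≡ B y x
B-sym zero    zero    = refl
B-sym zero    (suc y) = refl
B-sym (suc x) zero    = refl
B-sym (suc x) (suc y) =
  trans (cong₂ _+_ (B-sym x (suc y)) (B-sym (suc x) y)) (+-comm (B (suc y) x) (B y (suc x)))

B-zeroʳ : ∀ x → B x 0 ≡ 1
B-zeroʳ zero    = refl
B-zeroʳ (suc x) = refl

B-oneʳ : ∀ x → B x 1 ≡ suc x
B-oneʳ zero    = refl
B-oneʳ (suc x) = trans (cong₂ _+_ (B-oneʳ x) (B-zeroʳ (suc x))) (+-comm (suc x) 1)

B-absorbʳ : ∀ x y → suc y * B x (suc y) ≡ suc (x + y) * B x y
B-absorbʳ zero    y       = refl
B-absorbʳ (suc x) zero    = begin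
  1 * (B x 1 + 1)          ≡⟨ cong (λ t → 1 * (t + 1)) (B-oneʳ x) ⟩
  1 * (suc x + 1)          ≡⟨ normalise x ⟩
  suc (suc x + 0) * 1      ∎
  where
  normalise : ∀ x → 1 * (suc x + 1) ≡ suc (suc x + 0) * 1
  normalise = solve-∀
B-absorbʳ (suc x) (suc y) =
  pascalCombination (B x (suc (suc y))) (B x (suc y)) (B (suc x) y)
    (B-absorbʳ x (suc y)) (B-absorbʳ (suc x) y)
  where
  pascalCombination : ∀ u s t →
    suc (suc y) * u ≡ suc (x + suc y) * s → suc y * (s + t) ≡ suc (suc x + y) * t →
    suc (suc y) * (u + (s + t)) ≡ suc (suc x + suc y) * (s + t)
  pascalCombination u s t absorbU absorbST = begin
    suc (suc y) * (u + (s + t))                              ≡⟨ expand y u s t ⟩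
    suc (suc y) * u + suc y * (s + t) + (s + t)              ≡⟨ cong₂ (λ p q → p + q + (s + t)) absorbU absorbST ⟩
    suc (x + suc y) * s + suc (suc x + y) * t + (s + t)      ≡⟨ collect x y s t ⟩
    suc (suc x + suc y) * (s + t)                            ∎
    where
    expand : ∀ y u s t → suc (suc y) * (u + (s + t)) ≡ suc (suc y) * u + suc y * (s + t) + (s + t)
    expand = solve-∀
    collect : ∀ x y s t → suc (x + suc y) * s + suc (suc x + y) * t + (s + t) ≡ suc (suc x + suc y) * (s + t)
    collect = solve-∀

-- Trading a step between the two indices: (y+1) B x (y+1) = (x+1) B (x+1) y,
-- both sides being (x+y+1) B x y.
B-trade : ∀ x y → suc y * B x (suc y) ≡ suc x * B (suc x) y
B-trade x y = begin
  suc y * B x (suc y)    ≡⟨ B-absorbʳ x y ⟩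
  suc (x + y) * B x y    ≡⟨ cong₂ (λ m v → suc m * v) (+-comm x y) (B-sym x y) ⟩
  suc (y + x) * B y x    ≡⟨ sym (B-absorbʳ y x) ⟩
  suc x * B y (suc x)    ≡⟨ cong (suc x *_) (B-sym y (suc x)) ⟩
  suc x * B (suc x) y    ∎

sumBelow-cong : ∀ m {f g : ℕ → ℕ} → (∀ k → f k ≡ g k) → sumBelow m f ≡ sumBelow m g
sumBelow-cong zero    f≡g = refl
sumBelow-cong (suc m) f≡g = cong₂ _+_ (sumBelow-cong m f≡g) (f≡g m)

sumBelow-scale : ∀ p m (f : ℕ → ℕ) → p * sumBelow m f ≡ sumBelow m (λ k → p * f k)
sumBelow-scale p zero    f = *-zeroʳ p
sumBelow-scale p (suc m) f =
  trans (*-distribˡ-+ p (sumBelow m f) (f m)) (cong (_+ p * f m) (sumBelow-scale p m f))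

telescope : ∀ (u v g : ℕ → ℕ) → (∀ k → u k + g k ≡ v k + g (suc k)) →
  ∀ m → sumBelow m u + g 0 ≡ sumBelow m v + g m
telescope u v g step zero    = refl
telescope u v g step (suc m) = begin
  sumBelow m u + u m + g 0      ≡⟨ swapLast (sumBelow m u) (u m) (g 0) ⟩
  sumBelow m u + g 0 + u m      ≡⟨ cong (_+ u m) (telescope u v g step m) ⟩
  sumBelow m v + g m + u m      ≡⟨ swapInner (sumBelow m v) (g m) (u m) ⟩
  sumBelow m v + (u m + g m)    ≡⟨ cong (sumBelow m v +_) (step m) ⟩
  sumBelow m v + (v m + g (suc m)) ≡⟨ reassociate (sumBelow m v) (v m) (g (suc m)) ⟩
  sumBelow m v + v m + g (suc m) ∎
  where
  swapLast : ∀ a b c → a + b + c ≡ a + c + b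
  swapLast = solve-∀
  swapInner : ∀ a b c → a + b + c ≡ a + (c + b)
  swapInner = solve-∀
  reassociate : ∀ a b c → a + (b + c) ≡ a + b + c
  reassociate = solve-∀

-- The polynomial identity behind one telescoping step.  Dividing by q·r, it is
-- the rational identity
--   ((n+b+2)/(b+2))·X + Y = V + ((n+c+2)/(c+2))·U
-- where, in units of W, X = (b+c+3)/(c+2), U = (b+c+3)/(b+2), Y = (c+1)/(b+2),
-- V = (b+1)/(c+2); it is checked after clearing the denominators (b+2)(c+2).
telescopingArithmetic : ∀ n b c p q r r′ X Y U V W →
  suc (suc b) * p ≡ suc (n + suc b) * q →
  suc (suc c) * r′ ≡ suc (n + suc c) * r →
  suc (suc c) * X ≡ suc (suc b + suc c) * W →
  suc (suc b) * U ≡ suc (suc c + suc b) * W →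
  suc (suc b) * Y ≡ suc c * W →
  suc (suc c) * V ≡ suc b * W →
  p * (X * r) + r * (Y * q) ≡ q * (V * r) + r′ * (U * q)
telescopingArithmetic n b c p q r r′ X Y U V W p/q r′/r X/W U/W Y/W V/W =
  *-cancelˡ-≡ _ _ (suc (suc b) * suc (suc c)) (begin
    suc (suc b) * suc (suc c) * (p * (X * r) + r * (Y * q))
      ≡⟨ groupLeft b c p q r X Y ⟩
    (suc (suc b) * p) * (suc (suc c) * X) * r + (suc (suc b) * Y) * (suc (suc c) * r) * q
      ≡⟨ cong₂ _+_ (cong₂ (λ s t → s * t * r) p/q X/W) (cong (λ s → s * (suc (suc c) * r) * q) Y/W) ⟩
    suc (n + suc b) * q * (suc (suc b + suc c) * W) * r + suc c * W * (suc (suc c) * r) * q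
      ≡⟨ clearedIdentity n b c q r W ⟩
    suc (suc c + suc b) * W * (suc (n + suc c) * r) * q + suc b * W * (suc (suc b) * q) * r
      ≡⟨ sym (cong₂ _+_ (cong₂ (λ s t → s * t * q) U/W r′/r) (cong (λ s → s * (suc (suc b) * q) * r) V/W)) ⟩
    (suc (suc b) * U) * (suc (suc c) * r′) * q + (suc (suc c) * V) * (suc (suc b) * q) * r
      ≡⟨ groupRight b c q r r′ U V ⟩
    suc (suc b) * suc (suc c) * (q * (V * r) + r′ * (U * q)) ∎)
  where
  groupLeft : ∀ b c p q r X Y →
    suc (suc b) * suc (suc c) * (p * (X * r) + r * (Y * q))
      ≡ (suc (suc b) * p) * (suc (suc c) * X) * r + (suc (suc b) * Y) * (suc (suc c) * r) * q
  groupLeft = solve-∀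
  clearedIdentity : ∀ n b c q r W →
    suc (n + suc b) * q * (suc (suc b + suc c) * W) * r + suc c * W * (suc (suc c) * r) * q
      ≡ suc (suc c + suc b) * W * (suc (n + suc c) * r) * q + suc b * W * (suc (suc b) * q) * r
  clearedIdentity = solve-∀
  groupRight : ∀ b c q r r′ U V →
    (suc (suc b) * U) * (suc (suc c) * r′) * q + (suc (suc c) * V) * (suc (suc b) * q) * r
      ≡ suc (suc b) * suc (suc c) * (q * (V * r) + r′ * (U * q))
  groupRight = solve-∀

module WeightedSums (n : ℕ) where

  S : ℕ → ℕ → ℕ
  S a m = sumBelow m (λ k → B a (suc k) * B n k)

  -- Φ a b is the left-hand side of the theorem for r = a+1, s = b+1.
  Φ : ℕ → ℕ → ℕ
  Φ a b = B n (suc a) * S a (suc b)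

  -- The common increment of Φ in either index.
  δ : ℕ → ℕ → ℕ
  δ a b = B n (suc a) * (B a (suc (suc b)) * B n (suc b))

  boundary : ℕ → ℕ → ℕ
  boundary b zero    = 0
  boundary b (suc a) = δ a b

  raiseStep : ∀ b k →
    B n (suc (suc b)) * (B (suc b) (suc k) * B n k) + boundary b k
      ≡ B n (suc b) * (B b (suc k) * B n k) + boundary b (suc k)
  raiseStep b zero
    rewrite B-zeroʳ n | B-oneʳ (suc b) | B-oneʳ b | B-oneʳ n =
      trans (lhsNormal b p) (trans (B-absorbʳ n (suc b)) (rhsNormal n b q))
    where
    p = B n (suc (suc b))
    q = B n (suc b)
    lhsNormal : ∀ b p → p * (suc (suc b) * 1) + 0 ≡ suc (suc b) * p
    lhsNormal = solve-∀
    rhsNormal : ∀ n b q → suc (n + suc b) * q ≡ q * (suc b * 1) + suc n * (1 * q)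
    rhsNormal = solve-∀
  raiseStep b (suc c) =
    telescopingArithmetic n b c
      (B n (suc (suc b))) (B n (suc b)) (B n (suc c)) (B n (suc (suc c)))
      (B (suc b) (suc (suc c))) (B c (suc (suc b))) (B (suc c) (suc (suc b))) (B b (suc (suc c)))
      W
      (B-absorbʳ n (suc b))
      (B-absorbʳ n (suc c))
      (B-absorbʳ (suc b) (suc c))
      (trans (B-absorbʳ (suc c) (suc b)) (cong (suc (suc c + suc b) *_) (B-sym (suc c) (suc b))))
      (trans (B-trade c (suc b)) (cong (suc c *_) (B-sym (suc c) (suc b))))
      (B-trade b (suc c))
    where
    W = B (suc b) (suc c)

  S-raise : ∀ b m → B n (suc (suc b)) * S (suc b) m ≡ B n (suc b) * S b m + boundary b m
  S-raise b m = begin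
    p * S (suc b) m                         ≡⟨ sym (+-identityʳ _) ⟩
    p * S (suc b) m + 0                     ≡⟨ cong (_+ 0) (sumBelow-scale p m _) ⟩
    sumBelow m (λ k → p * (B (suc b) (suc k) * B n k)) + 0
      ≡⟨ telescope _ _ (boundary b) (raiseStep b) m ⟩
    sumBelow m (λ k → q * (B b (suc k) * B n k)) + boundary b m
      ≡⟨ cong (_+ boundary b m) (sym (sumBelow-scale q m _)) ⟩
    q * S b m + boundary b m                ∎
    where
    p = B n (suc (suc b))
    q = B n (suc b)

  Φ-raiseFirst : ∀ a b → Φ (suc b) a ≡ Φ b a + δ a b
  Φ-raiseFirst a b = S-raise b (suc a)

  Φ-raiseSecond : ∀ a b → Φ a (suc b) ≡ Φ a b + δ a b
  Φ-raiseSecond a b = *-distribˡ-+ (B n (suc a)) (S a (suc b)) _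

  -- Both indices raise Φ by the same amount, so Φ is symmetric.
  Φ-sym : ∀ a b → Φ a b ≡ Φ b a
  Φ-sym zero    zero    = refl
  Φ-sym (suc a) zero    = begin
    Φ (suc a) zero     ≡⟨ Φ-raiseFirst zero a ⟩
    Φ a zero + δ 0 a   ≡⟨ cong (_+ δ 0 a) (Φ-sym a zero) ⟩
    Φ zero a + δ 0 a   ≡⟨ sym (Φ-raiseSecond zero a) ⟩
    Φ zero (suc a)     ∎
  Φ-sym a       (suc b) = begin
    Φ a (suc b)        ≡⟨ Φ-raiseSecond a b ⟩
    Φ a b + δ a b      ≡⟨ cong (_+ δ a b) (Φ-sym a b) ⟩
    Φ b a + δ a b      ≡⟨ sym (Φ-raiseFirst a b) ⟩
    Φ (suc b) a        ∎

open WeightedSums using (Φ; Φ-sym)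

theoremSide≡Φ : ∀ n a b →
  ((n + suc a) C n) * sumBelow (suc b) (λ k → ((suc a + k) C a) * ((n + k) C n)) ≡ Φ n a b
theoremSide≡Φ n a b = cong₂ _*_ (sym (B≡C n (suc a))) (sumBelow-cong (suc b) summand)
  where
  summand : ∀ k → ((suc a + k) C a) * ((n + k) C n) ≡ B a (suc k) * B n k
  summand k = cong₂ _*_ (trans (cong (_C a) (sym (+-suc a k))) (sym (B≡C a (suc k)))) (sym (B≡C n k))

mainTheorem3 : (n r s : ℕ) → n ≥ 1 → r ≥ 1 → s ≥ 1 →
    ((n + r) C n) * sumBelow s (λ k → ((r + k) C (r ∸ 1)) * ((n + k) C n))
      ≡ ((n + s) C n) * sumBelow r (λ k → ((s + k) C (s ∸ 1)) * ((n + k) C n))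
mainTheorem3 n (suc a) (suc b) _ (s≤s z≤n) (s≤s z≤n) = begin
  ((n + suc a) C n) * sumBelow (suc b) (λ k → ((suc a + k) C a) * ((n + k) C n)) ≡⟨ theoremSide≡Φ n a b ⟩
  Φ n a b                                                                         ≡⟨ Φ-sym n a b ⟩
  Φ n b a                                                                         ≡⟨ sym (theoremSide≡Φ n b a) ⟩
  ((n + suc b) C n) * sumBelow (suc a) (λ k → ((suc b + k) C b) * ((n + k) C n)) ∎
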